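{- Every positive integer $r$ with $r\equiv 10\pmod{24}$ is distinguished with respect to $(3,1)$.
   Context: For integers $s$ and $r\ge 1$ with $\gcd(r,s)=1$, $\operatorname{ord}_r(s)$ denotes the least positive integer $m$ with $s^m\equiv 1\pmod r$. An integer $r\ge 2$ is distinguished with respect to $(3,1)$ if $\gcd(r,3)=1$ and $r$ divides $\frac{3^{\operatorname{ord}_r(3)}-1}{3-1}$. -}

module Defs where

open import Data.Nat using (ℕ; suc; _∸_; _^_; _<_; _≤_)
open import Data.Nat.Divisibility using (_∣_)
open import Data.Nat.DivMod using (_/_)
open import Data.Nat.GCD using (gcd)
open import Data.Product using (Σ; _×_)
open import Relation.Binary.PropositionalEquality using (_≡_)
open import Relation.Nullary using (¬_)

-- s^m ≡ 1 (mod r), written as r ∣ s^m - 1 (note s^m ≥ 1 when s ≥ 1)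
PowCongOne : ℕ → ℕ → ℕ → Set
PowCongOne r s m = r ∣ (s ^ m ∸ 1)

IsOrd : ℕ → ℕ → ℕ → Set
IsOrd r s m = (0 < m) × PowCongOne r s m × (∀ k → 0 < k → k < m → ¬ PowCongOne r s k)

Distinguished31 : ℕ → Set
Distinguished31 r =
  (2 ≤ r) × (gcd r 3 ≡ 1) ×
  Σ ℕ (λ m → IsOrd r 3 m × r ∣ ((3 ^ m ∸ 1) / 2))

-- Write r = 2s, so s ≡ 5 (mod 12), and let m = ord_r 3. If m were odd, then
-- 3^(m+1) ≡ 3 (mod s) would make 3 a square modulo s. But 3 is not a square
-- modulo any n ≡ 5, 7 (mod 12), by descent: if y² = 3 + kn with y < n then
-- k < n, and the congruence modulo 72 = 8·9 forces k = d·k′ with d ∣ 6 and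
-- k′ ≡ 5, 7 (mod 12), so 3 is a square modulo the smaller k′. Hence m is even,
-- 8 ∣ 9^(m/2) − 1 = 3^m − 1, and since s is odd, 2r = 4s divides 3^m − 1.
module Submission where

open import Defs
open import Data.Nat
open import Data.Nat.Properties
open import Data.Nat.DivMod
open import Data.Nat.Divisibility
open import Data.Nat.Coprimality using (Coprime; coprime?; coprime-divisor; coprime⇒gcd≡1; 1-coprimeTo)
import Data.Nat.Coprimality as Coprimality
open import Data.Nat.Induction using (<-rec)
open import Data.Nat.Tactic.RingSolver using (solve-∀)
open import Data.Empty using (⊥-elim)
open import Data.Fin using (toℕ; fromℕ<)
open import Data.Fin.Properties using (pigeonhole; toℕ-fromℕ<)
open import Data.Product using (∃; _×_; _,_; proj₁; proj₂)
open import Data.Sum using (_⊎_; inj₁; inj₂; [_,_])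
open import Function using (case_of_)
open import Relation.Nullary using (¬_; yes; no)
open import Relation.Nullary.Decidable using (_⊎-dec_; _×-dec_; _→-dec_; toWitness; from-yes)
open import Relation.Unary using (Pred; Decidable)
open import Relation.Binary.PropositionalEquality
  using (_≡_; refl; sym; trans; cong; cong₂; subst; module ≡-Reasoning)

open ≡-Reasoning

module _ {p} {P : Pred ℕ p} (P? : Decidable P) where

  least : ∀ n → P n → ∃ λ m → P m × (∀ k → k < m → ¬ P k)
  least = <-rec _ λ n smaller Pn → case anyUpTo? P? n of λ where
    (yes (k , k<n , Pk)) → smaller k<n Pk
    (no ∄k<n)            → n , Pn , λ k k<n Pk → ∄k<n (k , k<n , Pk)

m%n≡o%n⇒n∣m∸o : ∀ m o n .{{_ : NonZero n}} → m % n ≡ o % n → n ∣ m ∸ o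
m%n≡o%n⇒n∣m∸o m o n m%n≡o%n = divides (m / n ∸ o / n) (begin
  m ∸ o                                     ≡⟨ cong₂ _∸_ (m≡m%n+[m/n]*n m n) (m≡m%n+[m/n]*n o n) ⟩
  (m % n + m / n * n) ∸ (o % n + o / n * n) ≡⟨ cong (λ x → (m % n + m / n * n) ∸ (x + o / n * n)) m%n≡o%n ⟨
  (m % n + m / n * n) ∸ (m % n + o / n * n) ≡⟨ [m+n]∸[m+o]≡n∸o (m % n) _ _ ⟩
  m / n * n ∸ o / n * n                     ≡⟨ *-distribʳ-∸ n (m / n) (o / n) ⟨
  (m / n ∸ o / n) * n                       ∎)

coprime-*ʳ : ∀ {m n o} → Coprime m n → Coprime m o → Coprime m (n * o)
coprime-*ʳ {m} {n} {o} m⊥n m⊥o {d} (d∣m , d∣no) = m⊥o (d∣m , coprime-divisor d⊥n d∣no)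
  where
  d⊥n : Coprime d n
  d⊥n (e∣d , e∣n) = m⊥n (∣-trans e∣d d∣m , e∣n)

coprime-^ʳ : ∀ {m n} → Coprime m n → ∀ k → Coprime m (n ^ k)
coprime-^ʳ {m} m⊥n zero    = Coprimality.sym (1-coprimeTo m)
coprime-^ʳ     m⊥n (suc k) = coprime-*ʳ m⊥n (coprime-^ʳ m⊥n k)

powCongOne-exists : ∀ r s .{{_ : NonZero r}} → Coprime r s →
                    ∃ λ m → 0 < m × PowCongOne r s m
powCongOne-exists r s r⊥s
  with i , j , i<j , same-residue ← pigeonhole (n<1+n r) (λ i → fromℕ< (m%n<n (s ^ toℕ i) r))
  = d , m<n⇒0<n∸m i<j , coprime-divisor (coprime-^ʳ r⊥s (toℕ i)) r∣sⁱ[sᵈ∸1]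
  where
  d = toℕ j ∸ toℕ i
  residues≡ : s ^ toℕ j % r ≡ s ^ toℕ i % r
  residues≡ = begin
    s ^ toℕ j % r                             ≡⟨ toℕ-fromℕ< (m%n<n (s ^ toℕ j) r) ⟨
    toℕ (fromℕ< (m%n<n (s ^ toℕ j) r))        ≡⟨ cong toℕ same-residue ⟨
    toℕ (fromℕ< (m%n<n (s ^ toℕ i) r))        ≡⟨ toℕ-fromℕ< (m%n<n (s ^ toℕ i) r) ⟩
    s ^ toℕ i % r                             ∎
  sʲ∸sⁱ≡sⁱ[sᵈ∸1] : s ^ toℕ j ∸ s ^ toℕ i ≡ s ^ toℕ i * (s ^ d ∸ 1)
  sʲ∸sⁱ≡sⁱ[sᵈ∸1] = begin
    s ^ toℕ j ∸ s ^ toℕ i             ≡⟨ cong (λ e → s ^ e ∸ s ^ toℕ i) (m+[n∸m]≡n (<⇒≤ i<j)) ⟨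
    s ^ (toℕ i + d) ∸ s ^ toℕ i       ≡⟨ cong (_∸ s ^ toℕ i) (^-distribˡ-+-* s (toℕ i) d) ⟩
    s ^ toℕ i * s ^ d ∸ s ^ toℕ i     ≡⟨ cong (s ^ toℕ i * s ^ d ∸_) (*-identityʳ (s ^ toℕ i)) ⟨
    s ^ toℕ i * s ^ d ∸ s ^ toℕ i * 1 ≡⟨ *-distribˡ-∸ (s ^ toℕ i) (s ^ d) 1 ⟨
    s ^ toℕ i * (s ^ d ∸ 1)           ∎
  r∣sⁱ[sᵈ∸1] : r ∣ s ^ toℕ i * (s ^ d ∸ 1)
  r∣sⁱ[sᵈ∸1] = subst (r ∣_) sʲ∸sⁱ≡sⁱ[sᵈ∸1] (m%n≡o%n⇒n∣m∸o (s ^ toℕ j) (s ^ toℕ i) r residues≡)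

order-exists : ∀ r s .{{_ : NonZero r}} → Coprime r s → ∃ λ m → IsOrd r s m
order-exists r s r⊥s with M , 0<M , r∣sᴹ∸1 ← powCongOne-exists r s r⊥s
  with m , (0<m , r∣sᵐ∸1) , below ← least (λ k → 0 <? k ×-dec r ∣? s ^ k ∸ 1) M (0<M , r∣sᴹ∸1)
  = m , 0<m , r∣sᵐ∸1 , λ k 0<k k<m r∣sᵏ∸1 → below k k<m (0<k , r∣sᵏ∸1)

SquareRootMod : ℕ → ℕ → Set
SquareRootMod a n = ∃ λ y → ∃ λ k → y * y ≡ a + k * n

FiveOrSevenMod12 : ℕ → Set
FiveOrSevenMod12 n = n % 12 ≡ 5 ⊎ n % 12 ≡ 7

fiveOrSevenMod12? : Decidable FiveOrSevenMod12
fiveOrSevenMod12? n = n % 12 ≟ 5 ⊎-dec n % 12 ≟ 7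

fiveOrSevenMod12⇒3<n : ∀ {n} → FiveOrSevenMod12 n → 3 < n
fiveOrSevenMod12⇒3<n {n} n≡5,7 = <-≤-trans ([ 3<residue , 3<residue ] n≡5,7) (m%n≤m n 12)
  where
  3<residue : ∀ {c} → n % 12 ≡ 4 + c → 3 < n % 12
  3<residue eq = subst (3 <_) (sym eq) (s<s (s<s (s<s z<s)))

-- k = (1 + d) · c with 1 + d ∣ 6 and c ≡ 5, 7 (mod 12); the bound d < 6 makes
-- this decidable.
CofactorFiveOrSeven : ℕ → Set
CofactorFiveOrSeven k = ∃ λ d → d < 6 × suc d ∣ 6 × suc d ∣ k × FiveOrSevenMod12 (k / suc d)

cofactorFiveOrSeven? : Decidable CofactorFiveOrSeven
cofactorFiveOrSeven? k =
  anyUpTo? (λ d → suc d ∣? 6 ×-dec suc d ∣? k ×-dec fiveOrSevenMod12? (k / suc d)) 6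

-- The descent step, checked on residues modulo 72: the 2- and 3-parts of k,
-- and k′ modulo 12, are determined by k modulo 8·9.
ResidueClaim : ℕ → Set
ResidueClaim n = FiveOrSevenMod12 n → ∀ {k} → k < 72 → ∀ {y} → y < 72 →
                 y * y % 72 ≡ (3 + k * n) % 72 → CofactorFiveOrSeven k

residueClaim? : Decidable ResidueClaim
residueClaim? n = fiveOrSevenMod12? n →-dec
  allUpTo? (λ k → allUpTo? (λ y → y * y % 72 ≟ (3 + k * n) % 72 →-dec cofactorFiveOrSeven? k) 72) 72

residueClaim : ∀ {n} → n < 72 → ResidueClaim n
residueClaim = toWitness {a? = allUpTo? residueClaim? 72} _

fiveOrSevenMod12-resp : ∀ {m n} → m % 12 ≡ n % 12 → FiveOrSevenMod12 m → FiveOrSevenMod12 n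
fiveOrSevenMod12-resp m≡n = subst (λ c → c ≡ 5 ⊎ c ≡ 7) m≡n

residue-cofactor : ∀ {n y k} → FiveOrSevenMod12 n → y * y ≡ 3 + k * n →
                  CofactorFiveOrSeven (k % 72)
residue-cofactor {n} {y} {k} n≡5,7 y²≡3+kn =
  residueClaim (m%n<n n 72) n%72≡5,7 (m%n<n k 72) (m%n<n y 72) residues≡
  where
  n%72≡5,7 : FiveOrSevenMod12 (n % 72)
  n%72≡5,7 = fiveOrSevenMod12-resp {n} {n % 72} (sym (m∣n⇒o%n%m≡o%m 12 72 n (divides 6 refl))) n≡5,7
  residues≡ : y % 72 * (y % 72) % 72 ≡ (3 + k % 72 * (n % 72)) % 72
  residues≡ = begin
    y % 72 * (y % 72) % 72            ≡⟨ %-distribˡ-* y y 72 ⟨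
    y * y % 72                        ≡⟨ cong (_% 72) y²≡3+kn ⟩
    (3 + k * n) % 72                  ≡⟨ %-distribˡ-+ 3 (k * n) 72 ⟩
    (3 + k * n % 72) % 72             ≡⟨ cong (λ x → (3 + x) % 72) (%-distribˡ-* k n 72) ⟩
    (3 + k % 72 * (n % 72) % 72) % 72 ≡⟨ %-distribˡ-+ 3 (k % 72 * (n % 72)) 72 ⟨
    (3 + k % 72 * (n % 72)) % 72      ∎

cofactor-lift : ∀ k → CofactorFiveOrSeven (k % 72) →
                ∃ λ d → ∃ λ k′ → k ≡ suc d * k′ × FiveOrSevenMod12 k′
cofactor-lift k (d , _ , d+1∣6 , d+1∣k%72 , c≡5,7) =
  d , c + q * e * 12 , k≡[d+1]k′ , fiveOrSevenMod12-resp {c} {c + q * e * 12} (sym ([m+kn]%n≡m%n c (q * e) 12)) c≡5,7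
  where
  c = k % 72 / suc d
  e = 6 / suc d
  q = k / 72
  regroup : ∀ d c q e → suc d * c + q * (12 * (suc d * e)) ≡ suc d * (c + q * e * 12)
  regroup = solve-∀
  k≡[d+1]k′ : k ≡ suc d * (c + q * e * 12)
  k≡[d+1]k′ = begin
    k                                  ≡⟨ m≡m%n+[m/n]*n k 72 ⟩
    k % 72 + q * 72                    ≡⟨ cong₂ (λ a b → a + q * (12 * b)) (m*[n/m]≡n d+1∣k%72) (m*[n/m]≡n d+1∣6) ⟨
    suc d * c + q * (12 * (suc d * e)) ≡⟨ regroup d c q e ⟩
    suc d * (c + q * e * 12)           ∎

reduce-square-root : ∀ {a y k n} .{{_ : NonZero n}} → a < n → y * y ≡ a + k * n →
                     y % n * (y % n) ≡ a + y % n * (y % n) / n * n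
reduce-square-root {a} {y} {k} {n} a<n y²≡a+kn = begin
  z * z                     ≡⟨ m≡m%n+[m/n]*n (z * z) n ⟩
  z * z % n + z * z / n * n ≡⟨ cong (_+ z * z / n * n) z²%n≡a ⟩
  a + z * z / n * n         ∎
  where
  z = y % n
  z²%n≡a : z * z % n ≡ a
  z²%n≡a = begin
    z * z % n       ≡⟨ %-distribˡ-* y y n ⟨
    y * y % n       ≡⟨ cong (_% n) y²≡a+kn ⟩
    (a + k * n) % n ≡⟨ [m+kn]%n≡m%n a k n ⟩
    a % n           ≡⟨ m<n⇒m%n≡m a<n ⟩
    a               ∎

smaller-square-root-of-3 : ∀ {n} → FiveOrSevenMod12 n → SquareRootMod 3 n →
                           ∃ λ n′ → n′ < n × FiveOrSevenMod12 n′ × SquareRootMod 3 n′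
smaller-square-root-of-3 {n} n≡5,7 (y , k , y²≡3+kn) =
  shrink (cofactor-lift k₁ (residue-cofactor {n} {z} {k₁} n≡5,7 z²≡3+k₁n))
  where
  3<n = fiveOrSevenMod12⇒3<n n≡5,7
  instance
    n≢0 : NonZero n
    n≢0 = >-nonZero (<-trans z<s 3<n)
  z = y % n
  k₁ = z * z / n
  z²≡3+k₁n : z * z ≡ 3 + k₁ * n
  z²≡3+k₁n = reduce-square-root {3} {y} {k} 3<n y²≡3+kn
  k₁<n : k₁ < n
  k₁<n = m<n*o⇒m/o<n (*-mono-< (m%n<n y n) (m%n<n y n))
  swap : ∀ a b c → a * b * c ≡ a * c * b
  swap = solve-∀
  shrink : (∃ λ d → ∃ λ k′ → k₁ ≡ suc d * k′ × FiveOrSevenMod12 k′) →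
           ∃ λ n′ → n′ < n × FiveOrSevenMod12 n′ × SquareRootMod 3 n′
  shrink (d , k′ , k₁≡[d+1]k′ , k′≡5,7) =
    k′ , k′<n , k′≡5,7 , z , suc d * n , (begin
      z * z              ≡⟨ z²≡3+k₁n ⟩
      3 + k₁ * n         ≡⟨ cong (λ x → 3 + x * n) k₁≡[d+1]k′ ⟩
      3 + suc d * k′ * n ≡⟨ cong (3 +_) (swap (suc d) k′ n) ⟩
      3 + suc d * n * k′ ∎)
    where
    k′<n = ≤-<-trans (subst (k′ ≤_) (sym k₁≡[d+1]k′) (m≤n*m k′ (suc d))) k₁<n

no-square-root-of-3 : ∀ n → FiveOrSevenMod12 n → ¬ SquareRootMod 3 n
no-square-root-of-3 = <-rec (λ n → FiveOrSevenMod12 n → ¬ SquareRootMod 3 n) descend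
  where
  descend : ∀ n → (∀ {m} → m < n → FiveOrSevenMod12 m → ¬ SquareRootMod 3 m) →
            FiveOrSevenMod12 n → ¬ SquareRootMod 3 n
  descend n smaller n≡5,7 root = refute (smaller-square-root-of-3 n≡5,7 root)
    where
    refute : ¬ (∃ λ n′ → n′ < n × FiveOrSevenMod12 n′ × SquareRootMod 3 n′)
    refute (n′ , n′<n , n′≡5,7 , root′) = smaller n′<n n′≡5,7 root′

n∣[1+n]^k∸1 : ∀ n k → n ∣ suc n ^ k ∸ 1
n∣[1+n]^k∸1 n k = divides (proj₁ (expand k)) (cong (_∸ 1) (proj₂ (expand k)))
  where
  regroup : ∀ n q → suc n * (1 + q * n) ≡ 1 + (suc q + q * n) * n
  regroup = solve-∀
  expand : ∀ k → ∃ λ q → suc n ^ k ≡ 1 + q * n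
  expand zero    = 0 , refl
  expand (suc k) = let q , eq = expand k in
    suc q + q * n , trans (cong (suc n *_) eq) (regroup n q)

squareRoot-from-odd-power : ∀ a n j .{{_ : NonZero a}} → n ∣ a ^ suc (j * 2) ∸ 1 → SquareRootMod a n
squareRoot-from-odd-power a n j (divides q aᵐ∸1≡qn) = a ^ suc j , a * q , (begin
  a ^ suc j * a ^ suc j ≡⟨ ^-distribˡ-+-* a (suc j) (suc j) ⟨
  a ^ (suc j + suc j)   ≡⟨ cong (a ^_) (double j) ⟩
  a * a ^ m             ≡⟨ cong (a *_) (m∸n+n≡m (m^n>0 a m)) ⟨
  a * (a ^ m ∸ 1 + 1)   ≡⟨ cong (λ x → a * (x + 1)) aᵐ∸1≡qn ⟩
  a * (q * n + 1)       ≡⟨ expand a q n ⟩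
  a + a * q * n         ∎)
  where
  m = suc (j * 2)
  double : ∀ j → suc j + suc j ≡ suc (suc (j * 2))
  double = solve-∀
  expand : ∀ a q n → a * (q * n + 1) ≡ a + a * q * n
  expand = solve-∀

even-or-odd : ∀ m → ∃ λ j → m ≡ j * 2 ⊎ m ≡ suc (j * 2)
even-or-odd zero          = 0 , inj₁ refl
even-or-odd (suc zero)    = 0 , inj₂ refl
even-or-odd (suc (suc m)) with even-or-odd m
... | j , inj₁ refl = suc j , inj₁ refl
... | j , inj₂ refl = suc j , inj₂ refl

%-coprime⇒coprime : ∀ {n k m} .{{_ : NonZero k}} → m ∣ k → Coprime (n % k) m → Coprime n m
%-coprime⇒coprime m∣k n%k⊥m (d∣n , d∣m) = n%k⊥m (%-presˡ-∣ d∣n (∣-trans d∣m m∣k) , d∣m)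

coprime-*-∣ : ∀ {m n o} → Coprime m n → m ∣ o → n ∣ o → m * n ∣ o
coprime-*-∣ {m} {n} m⊥n m∣qn (divides q refl) =
  *-monoˡ-∣ n (coprime-divisor m⊥n (subst (m ∣_) (*-comm q n) m∣qn))

fiveOrSevenMod12-coprime : ∀ {s m} → FiveOrSevenMod12 s → m ∣ 12 → Coprime 5 m → Coprime 7 m →
                           Coprime s m
fiveOrSevenMod12-coprime {m = m} (inj₁ s%12≡5) m∣12 5⊥m _ =
  %-coprime⇒coprime m∣12 (subst (λ c → Coprime c m) (sym s%12≡5) 5⊥m)
fiveOrSevenMod12-coprime {m = m} (inj₂ s%12≡7) m∣12 _ 7⊥m =
  %-coprime⇒coprime m∣12 (subst (λ c → Coprime c m) (sym s%12≡7) 7⊥m)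

8∣3^[2j]∸1 : ∀ j → 8 ∣ 3 ^ (j * 2) ∸ 1
8∣3^[2j]∸1 j = subst (λ x → 8 ∣ x ∸ 1) 9ʲ≡3²ʲ (n∣[1+n]^k∸1 8 j)
  where
  9ʲ≡3²ʲ : 9 ^ j ≡ 3 ^ (j * 2)
  9ʲ≡3²ʲ = trans (^-*-assoc 3 2 j) (cong (3 ^_) (*-comm 2 j))

2s∣[3^[2j]∸1]/2 : ∀ s j → Coprime s 4 → s ∣ 3 ^ (j * 2) ∸ 1 → 2 * s ∣ (3 ^ (j * 2) ∸ 1) / 2
2s∣[3^[2j]∸1]/2 s j s⊥4 s∣3²ʲ∸1 =
  m*n∣o⇒m∣o/n (2 * s) 2 (subst (_∣ 3 ^ (j * 2) ∸ 1) (s*4≡2s*2 s) (coprime-*-∣ s⊥4 s∣3²ʲ∸1 4∣3²ʲ∸1))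
  where
  s*4≡2s*2 : ∀ s → s * 4 ≡ 2 * s * 2
  s*4≡2s*2 = solve-∀
  4∣3²ʲ∸1 : 4 ∣ 3 ^ (j * 2) ∸ 1
  4∣3²ʲ∸1 = ∣-trans (divides 2 refl) (8∣3^[2j]∸1 j)

distinguished31-twice : ∀ s → FiveOrSevenMod12 s → Distinguished31 (2 * s)
distinguished31-twice s s≡5,7 =
  *-monoʳ-≤ 2 0<s , coprime⇒gcd≡1 2s⊥3 , halve (order-exists (2 * s) 3 2s⊥3)
  where
  0<s : 0 < s
  0<s = <-trans z<s (fiveOrSevenMod12⇒3<n {s} s≡5,7)
  instance
    2s≢0 : NonZero (2 * s)
    2s≢0 = >-nonZero (*-monoʳ-< 2 0<s)
  s⊥3 : Coprime s 3
  s⊥3 = fiveOrSevenMod12-coprime s≡5,7 (divides 4 refl) (from-yes (coprime? 5 3)) (from-yes (coprime? 7 3))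
  s⊥4 : Coprime s 4
  s⊥4 = fiveOrSevenMod12-coprime s≡5,7 (divides 3 refl) (from-yes (coprime? 5 4)) (from-yes (coprime? 7 4))
  2s⊥3 : Coprime (2 * s) 3
  2s⊥3 = Coprimality.sym (coprime-*ʳ (from-yes (coprime? 3 2)) (Coprimality.sym s⊥3))
  half-divisible : ∀ m → 2 * s ∣ 3 ^ m ∸ 1 → 2 * s ∣ (3 ^ m ∸ 1) / 2
  half-divisible m 2s∣3ᵐ∸1 with even-or-odd m | ∣-trans (n∣m*n 2 {s}) 2s∣3ᵐ∸1
  ... | j , inj₁ refl | s∣3ᵐ∸1 = 2s∣[3^[2j]∸1]/2 s j s⊥4 s∣3ᵐ∸1
  ... | j , inj₂ refl | s∣3ᵐ∸1 =
    ⊥-elim (no-square-root-of-3 s s≡5,7 (squareRoot-from-odd-power 3 s j s∣3ᵐ∸1))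
  halve : ∃ (IsOrd (2 * s) 3) → ∃ λ m → IsOrd (2 * s) 3 m × 2 * s ∣ (3 ^ m ∸ 1) / 2
  halve (m , ord@(_ , 2s∣3ᵐ∸1 , _)) = m , ord , half-divisible m 2s∣3ᵐ∸1

-- The hypothesis 0 < r follows from r % 24 ≡ 10.
proposition2p7 : (r : ℕ) → 0 < r → r % 24 ≡ 10 → Distinguished31 r
proposition2p7 r _ r%24≡10 =
  subst Distinguished31 (sym r≡2s) (distinguished31-twice s (inj₁ ([m+kn]%n≡m%n 5 (r / 24) 12)))
  where
  s = 5 + r / 24 * 12
  halve : ∀ a → 10 + a * 24 ≡ 2 * (5 + a * 12)
  halve = solve-∀
  r≡2s : r ≡ 2 * s
  r≡2s = begin
    r                    ≡⟨ m≡m%n+[m/n]*n r 24 ⟩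
    r % 24 + r / 24 * 24 ≡⟨ cong (_+ r / 24 * 24) r%24≡10 ⟩
    10 + r / 24 * 24     ≡⟨ halve (r / 24) ⟩
    2 * s                ∎
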